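{- Let $A$ be a uniformly randomly chosen subset of $\{0,\dots,n-1\}$. Then for any integer $1\le k\le n/2$, $\Pr(k\notin A-A)\le (3/4)^{n/3}$, while for any integer $n/2\le k\le n-1$, $\Pr(k\notin A-A)=(3/4)^{n-k}$.
   Context: $A-A=\{a_1-a_2: a_1,a_2\in A\}$. "Uniformly randomly chosen" means each of the $2^n$ subsets has probability $2^{ -n}$. -}

module Defs where

open import Data.Nat using (ℕ; zero; suc; _+_; _≟_)
open import Data.Fin using (Fin; toℕ)
open import Data.Fin.Subset using (Subset; _∈_)
open import Data.Fin.Subset.Properties using (_∈?_)
open import Data.Fin.Properties using (any?)
open import Data.Bool using (true; false)
open import Data.Vec using (_∷_; [])
open import Data.List using (List; _∷_; []; map; _++_; length; filter)
open import Data.Product using (∃; _×_; _,_)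
open import Relation.Nullary using (Dec; ¬_)
open import Relation.Nullary.Decidable using (_×-dec_; ¬?)

allSubsets : (n : ℕ) → List (Subset n)
allSubsets zero    = [] ∷ []
allSubsets (suc n) = map (true ∷_) (allSubsets n) ++ map (false ∷_) (allSubsets n)

_∈Diff_ : ∀ {n} → ℕ → Subset n → Set
_∈Diff_ {n} k A = ∃ λ (a₁ : Fin n) → ∃ λ (a₂ : Fin n) → (a₁ ∈ A × a₂ ∈ A) × toℕ a₁ ≡ toℕ a₂ + k
  where open import Relation.Binary.PropositionalEquality using (_≡_)

_∈Diff?_ : ∀ {n} (k : ℕ) (A : Subset n) → Dec (k ∈Diff A)
k ∈Diff? A = any? λ a₁ → any? λ a₂ → ((a₁ ∈? A) ×-dec (a₂ ∈? A)) ×-dec (toℕ a₁ ≟ toℕ a₂ + k)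

-- Number of subsets A of {0,…,n-1} with k ∉ A - A.
-- Pr(k ∉ A - A) = missCount n k / 2^n  for uniformly random A.
missCount : ℕ → ℕ → ℕ
missCount n k = length (filter (λ A → ¬? (k ∈Diff? A)) (allSubsets n))

{-# OPTIONS --safe #-}
-- Restricting A to its first a and last b points shows that missCount is
-- submultiplicative in n.  For n/2 ≤ k < n, k ∉ A − A says exactly that the first
-- n − k and the last n − k points of A, matched by i ↦ i + k, form disjoint sets,
-- the 2k − n points in between being free: missCount n k = 3^(n−k) 2^(2k−n).
-- For 1 ≤ k ≤ n/2, splitting off blocks of length 2k (each worth missCount 2k k = 3^k)
-- until less than 2k points remain gives missCount n k ≤ 3^p 2^s with n = 2p + s and
-- s ≤ p, and such a product is at most 6^(n/3) = (3/4)^(n/3) 2^n.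
module Submission where

open import Defs
open import Data.Bool using (Bool; true; false; not; _∧_)
open import Data.Bool.Properties using (∧-zeroʳ)
open import Data.Fin using (Fin; zero; suc; toℕ)
open import Data.Fin.Subset using (Subset; _∈_)
open import Data.List using (List; []; _∷_; map; filter; length)
open import Data.List.Properties using (map-++; map-∘)
open import Data.Nat using (ℕ; zero; suc; _+_; _*_; _^_; _∸_; _≤_; _<_; _≤?_; z≤n; s≤s)
open import Data.Nat.Induction using (<-rec)
open import Data.Nat.ListAction using (sum)
open import Data.Nat.ListAction.Properties using (sum-++)
open import Data.Nat.Properties
open import Data.Nat.Solver using (module +-*-Solver)
open import Data.Nat.Tactic.RingSolver using (solve-∀)
open import Data.Product using (∃; ∃₂; _×_; _,_)
open import Data.Vec using (_∷_; []; _++_)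
open import Data.Vec.Base using (here; there)
open import Function using (_∘_; _⇔_; mk⇔; Equivalence)
open import Function.Construct.Composition using (_⇔-∘_)
open import Function.Construct.Symmetry using (⇔-sym)
open import Relation.Binary.PropositionalEquality
open import Relation.Nullary using (Dec; yes; no; does; ¬?; contradiction)
open import Relation.Unary using (Pred; Decidable)

open Equivalence using (to; from)
open import Algebra.Properties.CommutativeSemigroup +-commutativeSemigroup
  using () renaming (interchange to +-interchange)
open import Algebra.Properties.CommutativeSemigroup *-commutativeSemigroup
  using () renaming (interchange to *-interchange)
open +-*-Solver using (solve; _:*_; _:^_; con; _:=_)

private variable
  a b j m n k : ℕ

-- Sums over all subsets of {0,…,n-1}

𝟙 : Bool → ℕ
𝟙 true  = 1
𝟙 false = 0

length-filter≡sum-𝟙 : ∀ {ℓ₁ ℓ₂} {A : Set ℓ₁} {P : Pred A ℓ₂} (P? : Decidable P) (xs : List A) →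
                       length (filter P? xs) ≡ sum (map (𝟙 ∘ does ∘ P?) xs)
length-filter≡sum-𝟙 P? []       = refl
length-filter≡sum-𝟙 P? (x ∷ xs) with does (P? x)
... | true  = cong suc (length-filter≡sum-𝟙 P? xs)
... | false = length-filter≡sum-𝟙 P? xs

∑ : ∀ n → (Subset n → ℕ) → ℕ
∑ zero    f = f []
∑ (suc n) f = ∑ n (f ∘ (true ∷_)) + ∑ n (f ∘ (false ∷_))

sum-allSubsets : ∀ n (f : Subset n → ℕ) → sum (map f (allSubsets n)) ≡ ∑ n f
sum-allSubsets zero    f = +-identityʳ (f [])
sum-allSubsets (suc n) f = begin
  sum (map f (allSubsets (suc n)))
    ≡⟨ trans (cong sum (map-++ f (map (true ∷_) As) _)) (sum-++ (map f (map (true ∷_) As)) _) ⟩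
  sum (map f (map (true ∷_) As)) + sum (map f (map (false ∷_) As))
    ≡⟨ cong₂ (λ xs ys → sum xs + sum ys) (sym (map-∘ As)) (sym (map-∘ As)) ⟩
  sum (map (f ∘ (true ∷_)) As) + sum (map (f ∘ (false ∷_)) As)
    ≡⟨ cong₂ _+_ (sum-allSubsets n _) (sum-allSubsets n _) ⟩
  ∑ (suc n) f ∎
  where
  open ≡-Reasoning
  As = allSubsets n

∑-cong : ∀ n {f g : Subset n → ℕ} → (∀ A → f A ≡ g A) → ∑ n f ≡ ∑ n g
∑-cong zero    f≡g = f≡g []
∑-cong (suc n) f≡g = cong₂ _+_ (∑-cong n (f≡g ∘ (true ∷_))) (∑-cong n (f≡g ∘ (false ∷_)))

∑-mono-≤ : ∀ n {f g : Subset n → ℕ} → (∀ A → f A ≤ g A) → ∑ n f ≤ ∑ n g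
∑-mono-≤ zero    f≤g = f≤g []
∑-mono-≤ (suc n) f≤g = +-mono-≤ (∑-mono-≤ n (f≤g ∘ (true ∷_))) (∑-mono-≤ n (f≤g ∘ (false ∷_)))

∑-distrib-+ : ∀ n (f g : Subset n → ℕ) → ∑ n (λ A → f A + g A) ≡ ∑ n f + ∑ n g
∑-distrib-+ zero    f g = refl
∑-distrib-+ (suc n) f g = begin
  ∑ n (λ A → f (true ∷ A) + g (true ∷ A)) + ∑ n (λ A → f (false ∷ A) + g (false ∷ A))
    ≡⟨ cong₂ _+_ (∑-distrib-+ n _ _) (∑-distrib-+ n _ _) ⟩
  (∑ n (f ∘ (true ∷_)) + ∑ n (g ∘ (true ∷_))) + (∑ n (f ∘ (false ∷_)) + ∑ n (g ∘ (false ∷_)))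
    ≡⟨ +-interchange (∑ n (f ∘ (true ∷_))) _ _ _ ⟩
  ∑ (suc n) f + ∑ (suc n) g ∎
  where open ≡-Reasoning

∑-distribˡ-* : ∀ n c (f : Subset n → ℕ) → ∑ n (λ A → c * f A) ≡ c * ∑ n f
∑-distribˡ-* zero    c f = refl
∑-distribˡ-* (suc n) c f = trans (cong₂ _+_ (∑-distribˡ-* n c _) (∑-distribˡ-* n c _))
                                 (sym (*-distribˡ-+ c _ _))

∑-distribʳ-* : ∀ n c (f : Subset n → ℕ) → ∑ n (λ A → f A * c) ≡ ∑ n f * c
∑-distribʳ-* n c f = begin
  ∑ n (λ A → f A * c) ≡⟨ ∑-cong n (λ A → *-comm (f A) c) ⟩
  ∑ n (λ A → c * f A) ≡⟨ ∑-distribˡ-* n c f ⟩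
  c * ∑ n f           ≡⟨ *-comm c _ ⟩
  ∑ n f * c           ∎
  where open ≡-Reasoning

∑-const : ∀ n c → ∑ n (λ _ → c) ≡ c * 2 ^ n
∑-const zero    c = sym (*-identityʳ c)
∑-const (suc n) c = begin
  ∑ n (λ _ → c) + ∑ n (λ _ → c) ≡⟨ cong₂ _+_ (∑-const n c) (∑-const n c) ⟩
  c * 2 ^ n + c * 2 ^ n         ≡⟨ double c (2 ^ n) ⟩
  c * (2 * 2 ^ n)               ∎
  where
  open ≡-Reasoning
  double : ∀ c x → c * x + c * x ≡ c * (2 * x)
  double = solve-∀

∑-++ : ∀ a b (f : Subset (a + b) → ℕ) → ∑ (a + b) f ≡ ∑ a (λ xs → ∑ b (λ ys → f (xs ++ ys)))
∑-++ zero    b f = refl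
∑-++ (suc a) b f = cong₂ _+_ (∑-++ a b _) (∑-++ a b _)

∑-++-≤-* : ∀ a b {f : Subset (a + b) → ℕ} {g : Subset a → ℕ} {h : Subset b → ℕ} →
           (∀ xs ys → f (xs ++ ys) ≤ g xs * h ys) → ∑ (a + b) f ≤ ∑ a g * ∑ b h
∑-++-≤-* a b {f} {g} {h} f≤g*h = begin
  ∑ (a + b) f                                   ≡⟨ ∑-++ a b f ⟩
  ∑ a (λ xs → ∑ b (λ ys → f (xs ++ ys)))        ≤⟨ ∑-mono-≤ a (λ xs → ∑-mono-≤ b (f≤g*h xs)) ⟩
  ∑ a (λ xs → ∑ b (λ ys → g xs * h ys))         ≡⟨ ∑-cong a (λ xs → ∑-distribˡ-* b (g xs) h) ⟩
  ∑ a (λ xs → g xs * ∑ b h)                     ≡⟨ ∑-distribʳ-* a (∑ b h) g ⟩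
  ∑ a g * ∑ b h                                 ∎
  where open ≤-Reasoning

-- Difference sets

-- Positions are read as natural numbers, so that moving past a block of _++_ is
-- addition; positions beyond n are outside.
lookupℕ : Subset n → ℕ → Bool
lookupℕ []      _       = false
lookupℕ (x ∷ _) zero    = x
lookupℕ (_ ∷ A) (suc i) = lookupℕ A i

_∈ᴺ_ : ℕ → Subset n → Set
i ∈ᴺ A = lookupℕ A i ≡ true

∈⇒∈ᴺ : {x : Fin n} {A : Subset n} → x ∈ A → toℕ x ∈ᴺ A
∈⇒∈ᴺ here        = refl
∈⇒∈ᴺ (there x∈A) = ∈⇒∈ᴺ x∈A

∈ᴺ⇒∈ : ∀ (A : Subset n) {i} → i ∈ᴺ A → ∃ λ x → toℕ x ≡ i × x ∈ A
∈ᴺ⇒∈ (_ ∷ A) {zero}  refl = zero , refl , here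
∈ᴺ⇒∈ (_ ∷ A) {suc i} i∈A with ∈ᴺ⇒∈ A i∈A
... | x , refl , x∈A = suc x , refl , there x∈A

∈ᴺ⇒< : ∀ (A : Subset n) {i} → i ∈ᴺ A → i < n
∈ᴺ⇒< (_ ∷ A) {zero}  _   = s≤s z≤n
∈ᴺ⇒< (_ ∷ A) {suc i} i∈A = s≤s (∈ᴺ⇒< A i∈A)

lookupℕ-++ˡ : ∀ (xs : Subset a) (ys : Subset b) {i} → i < a → lookupℕ (xs ++ ys) i ≡ lookupℕ xs i
lookupℕ-++ˡ (_ ∷ xs) ys {zero}  _         = refl
lookupℕ-++ˡ (_ ∷ xs) ys {suc i} (s≤s i<a) = lookupℕ-++ˡ xs ys i<a

lookupℕ-++ʳ : ∀ (xs : Subset a) (ys : Subset b) i → lookupℕ (xs ++ ys) (a + i) ≡ lookupℕ ys i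
lookupℕ-++ʳ []       ys i = refl
lookupℕ-++ʳ (_ ∷ xs) ys i = lookupℕ-++ʳ xs ys i

∈ᴺ-++⁺ˡ : ∀ (xs : Subset a) (ys : Subset b) {i} → i ∈ᴺ xs → i ∈ᴺ (xs ++ ys)
∈ᴺ-++⁺ˡ xs ys i∈xs = trans (lookupℕ-++ˡ xs ys (∈ᴺ⇒< xs i∈xs)) i∈xs

∈ᴺ-++⁺ʳ : ∀ (xs : Subset a) (ys : Subset b) {i} → i ∈ᴺ ys → (a + i) ∈ᴺ (xs ++ ys)
∈ᴺ-++⁺ʳ xs ys {i} i∈ys = trans (lookupℕ-++ʳ xs ys i) i∈ys

_∈Diffᴺ_ : ℕ → Subset n → Set
k ∈Diffᴺ A = ∃ λ i → i ∈ᴺ A × (i + k) ∈ᴺ A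

∈Diff⇔∈Diffᴺ : {A : Subset n} → k ∈Diff A ⇔ k ∈Diffᴺ A
∈Diff⇔∈Diffᴺ {A = A} = mk⇔ toᴺ fromᴺ
  where
  toᴺ : _ ∈Diff A → _ ∈Diffᴺ A
  toᴺ (x₁ , x₂ , (x₁∈A , x₂∈A) , x₁≡x₂+k) = toℕ x₂ , ∈⇒∈ᴺ x₂∈A , subst (_∈ᴺ A) x₁≡x₂+k (∈⇒∈ᴺ x₁∈A)
  fromᴺ : _ ∈Diffᴺ A → _ ∈Diff A
  fromᴺ (i , i∈A , i+k∈A) with ∈ᴺ⇒∈ A i∈A | ∈ᴺ⇒∈ A i+k∈A
  ... | x₂ , refl , x₂∈A | x₁ , x₁≡x₂+k , x₁∈A = x₁ , x₂ , (x₁∈A , x₂∈A) , x₁≡x₂+k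

∈Diff-++⁺ˡ : ∀ (xs : Subset a) (ys : Subset b) → k ∈Diff xs → k ∈Diff (xs ++ ys)
∈Diff-++⁺ˡ xs ys k∈xs-xs with to ∈Diff⇔∈Diffᴺ k∈xs-xs
... | i , i∈xs , i+k∈xs = from ∈Diff⇔∈Diffᴺ (i , ∈ᴺ-++⁺ˡ xs ys i∈xs , ∈ᴺ-++⁺ˡ xs ys i+k∈xs)

∈Diff-++⁺ʳ : ∀ (xs : Subset a) (ys : Subset b) → k ∈Diff ys → k ∈Diff (xs ++ ys)
∈Diff-++⁺ʳ {a} {k = k} xs ys k∈ys-ys with to ∈Diff⇔∈Diffᴺ k∈ys-ys
... | i , i∈ys , i+k∈ys = from ∈Diff⇔∈Diffᴺ (a + i , ∈ᴺ-++⁺ʳ xs ys i∈ys , a+i+k∈xs++ys)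
  where
  a+i+k∈xs++ys : (a + i + k) ∈ᴺ (xs ++ ys)
  a+i+k∈xs++ys = subst (_∈ᴺ (xs ++ ys)) (sym (+-assoc a i k)) (∈ᴺ-++⁺ʳ xs ys {i + k} i+k∈ys)

Overlap : Subset n → Subset n → Set
Overlap xs zs = ∃ λ i → i ∈ᴺ xs × i ∈ᴺ zs

disjoint : Subset n → Subset n → Bool
disjoint []       []       = true
disjoint (x ∷ xs) (z ∷ zs) = not (x ∧ z) ∧ disjoint xs zs

disjoint≡false⇔Overlap : ∀ (xs zs : Subset n) → disjoint xs zs ≡ false ⇔ Overlap xs zs
disjoint≡false⇔Overlap xs zs = mk⇔ (common xs zs) (not-disjoint xs zs)
  where
  common : ∀ (xs zs : Subset n) → disjoint xs zs ≡ false → Overlap xs zs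
  common []           []           ()
  common (true  ∷ xs) (true  ∷ zs) _ = zero , refl , refl
  common (true  ∷ xs) (false ∷ zs) d with common xs zs d
  ... | i , i∈xs , i∈zs = suc i , i∈xs , i∈zs
  common (false ∷ xs) (_     ∷ zs) d with common xs zs d
  ... | i , i∈xs , i∈zs = suc i , i∈xs , i∈zs
  not-disjoint : ∀ (xs zs : Subset n) → Overlap xs zs → disjoint xs zs ≡ false
  not-disjoint (true ∷ xs) (true ∷ zs) (zero , refl , refl) = refl
  not-disjoint (x ∷ xs) (z ∷ zs) (suc i , i∈xs , i∈zs) =
    trans (cong (not (x ∧ z) ∧_) (not-disjoint xs zs (i , i∈xs , i∈zs))) (∧-zeroʳ _)

module _ (xs : Subset j) (ys : Subset m) (zs : Subset j) where

  lookupℕ-++-++ : ∀ i → lookupℕ (xs ++ ys ++ zs) (i + (m + j)) ≡ lookupℕ zs i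
  lookupℕ-++-++ i = begin
    lookupℕ (xs ++ ys ++ zs) (i + (m + j)) ≡⟨ cong (lookupℕ (xs ++ ys ++ zs)) (shift i m j) ⟩
    lookupℕ (xs ++ ys ++ zs) (j + (m + i)) ≡⟨ lookupℕ-++ʳ xs (ys ++ zs) (m + i) ⟩
    lookupℕ (ys ++ zs) (m + i)             ≡⟨ lookupℕ-++ʳ ys zs i ⟩
    lookupℕ zs i                           ∎
    where
    open ≡-Reasoning
    shift : ∀ i m j → i + (m + j) ≡ j + (m + i)
    shift = solve-∀

  ∈Diff-++-++⇔Overlap : (m + j) ∈Diff (xs ++ ys ++ zs) ⇔ Overlap xs zs
  ∈Diff-++-++⇔Overlap = mk⇔ (common ∘ to ∈Diff⇔∈Diffᴺ) (from ∈Diff⇔∈Diffᴺ ∘ gap)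
    where
    common : (m + j) ∈Diffᴺ (xs ++ ys ++ zs) → Overlap xs zs
    common (i , i∈V , i+k∈V) = i , trans (sym (lookupℕ-++ˡ xs (ys ++ zs) (∈ᴺ⇒< zs i∈zs))) i∈V , i∈zs
      where i∈zs = trans (sym (lookupℕ-++-++ i)) i+k∈V
    gap : Overlap xs zs → (m + j) ∈Diffᴺ (xs ++ ys ++ zs)
    gap (i , i∈xs , i∈zs) = i , ∈ᴺ-++⁺ˡ xs (ys ++ zs) i∈xs , trans (lookupℕ-++-++ i) i∈zs

-- Counting the sets that avoid a difference

miss : ℕ → Subset n → ℕ
miss k A = 𝟙 (does (¬? (k ∈Diff? A)))

missCount≡∑miss : ∀ n k → missCount n k ≡ ∑ n (miss k)
missCount≡∑miss n k =
  trans (length-filter≡sum-𝟙 (λ A → ¬? (k ∈Diff? A)) (allSubsets n)) (sum-allSubsets n (miss k))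

𝟙≤1 : ∀ b → 𝟙 b ≤ 1
𝟙≤1 true  = ≤-refl
𝟙≤1 false = z≤n

𝟙-¬?≡𝟙 : ∀ {P : Set} (P? : Dec P) {b} → P ⇔ (b ≡ false) → 𝟙 (does (¬? P?)) ≡ 𝟙 b
𝟙-¬?≡𝟙 (yes p)  {false} _   = refl
𝟙-¬?≡𝟙 (yes p)  {true}  P⇔b = contradiction (to P⇔b p) λ ()
𝟙-¬?≡𝟙 (no ¬p)  {true}  _   = refl
𝟙-¬?≡𝟙 (no ¬p)  {false} P⇔b = contradiction (from P⇔b refl) ¬p

missCount≤2^n : ∀ n k → missCount n k ≤ 2 ^ n
missCount≤2^n n k = begin
  missCount n k      ≡⟨ missCount≡∑miss n k ⟩
  ∑ n (miss k)       ≤⟨ ∑-mono-≤ n (λ A → 𝟙≤1 (does (¬? (k ∈Diff? A)))) ⟩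
  ∑ n (λ _ → 1)      ≡⟨ ∑-const n 1 ⟩
  1 * 2 ^ n          ≡⟨ *-identityˡ (2 ^ n) ⟩
  2 ^ n              ∎
  where open ≤-Reasoning

miss-++ : ∀ k (xs : Subset a) (ys : Subset b) → miss k (xs ++ ys) ≤ miss k xs * miss k ys
miss-++ k xs ys with k ∈Diff? (xs ++ ys) | k ∈Diff? xs | k ∈Diff? ys
... | yes _ | _        | _        = z≤n
... | no k∉ | yes k∈xs | _        = contradiction (∈Diff-++⁺ˡ xs ys k∈xs) k∉
... | no k∉ | no _     | yes k∈ys = contradiction (∈Diff-++⁺ʳ xs ys k∈ys) k∉
... | no _  | no _     | no _     = ≤-refl

missCount-++ : ∀ a b k → missCount (a + b) k ≤ missCount a k * missCount b k
missCount-++ a b k = begin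
  missCount (a + b) k           ≡⟨ missCount≡∑miss (a + b) k ⟩
  ∑ (a + b) (miss k)            ≤⟨ ∑-++-≤-* a b (miss-++ k) ⟩
  ∑ a (miss k) * ∑ b (miss k)   ≡⟨ sym (cong₂ _*_ (missCount≡∑miss a k) (missCount≡∑miss b k)) ⟩
  missCount a k * missCount b k ∎
  where open ≤-Reasoning

miss-++-++ : ∀ (xs : Subset j) (ys : Subset m) zs → miss (m + j) (xs ++ ys ++ zs) ≡ 𝟙 (disjoint xs zs)
miss-++-++ xs ys zs = 𝟙-¬?≡𝟙 (_ ∈Diff? (xs ++ ys ++ zs))
  (⇔-sym (disjoint≡false⇔Overlap xs zs) ⇔-∘ ∈Diff-++-++⇔Overlap xs ys zs)

∑-disjoint : ∀ j → ∑ j (λ xs → ∑ j (λ zs → 𝟙 (disjoint xs zs))) ≡ 3 ^ j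
∑-disjoint zero    = refl
∑-disjoint (suc j) = begin
  ∑ j (λ xs → ∑ j (λ _ → 0) + D xs) + ∑ j (λ xs → D xs + D xs)
    ≡⟨ cong₂ _+_ (∑-cong j (λ xs → cong (_+ D xs) (∑-const j 0))) (∑-distrib-+ j D D) ⟩
  ∑ j D + (∑ j D + ∑ j D)
    ≡⟨ cong (λ t → t + (t + t)) (∑-disjoint j) ⟩
  3 ^ j + (3 ^ j + 3 ^ j)
    ≡⟨ cong (λ t → 3 ^ j + (3 ^ j + t)) (sym (+-identityʳ (3 ^ j))) ⟩
  3 ^ suc j ∎
  where
  open ≡-Reasoning
  D : Subset j → ℕ
  D xs = ∑ j (λ zs → 𝟙 (disjoint xs zs))

missCount-exact : ∀ j m → missCount (j + (m + j)) (m + j) ≡ 3 ^ j * 2 ^ m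
missCount-exact j m = begin
  missCount (j + (m + j)) (m + j)
    ≡⟨ missCount≡∑miss (j + (m + j)) (m + j) ⟩
  ∑ (j + (m + j)) (miss (m + j))
    ≡⟨ ∑-++ j (m + j) _ ⟩
  ∑ j (λ xs → ∑ (m + j) (λ ws → miss (m + j) (xs ++ ws)))
    ≡⟨ ∑-cong j (λ xs → ∑-++ m j _) ⟩
  ∑ j (λ xs → ∑ m (λ ys → ∑ j (λ zs → miss (m + j) (xs ++ ys ++ zs))))
    ≡⟨ ∑-cong j (λ xs → ∑-cong m (λ ys → ∑-cong j (miss-++-++ xs ys))) ⟩
  ∑ j (λ xs → ∑ m (λ _ → ∑ j (λ zs → 𝟙 (disjoint xs zs))))
    ≡⟨ ∑-cong j (λ xs → ∑-const m _) ⟩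
  ∑ j (λ xs → ∑ j (λ zs → 𝟙 (disjoint xs zs)) * 2 ^ m)
    ≡⟨ ∑-distribʳ-* j (2 ^ m) _ ⟩
  ∑ j (λ xs → ∑ j (λ zs → 𝟙 (disjoint xs zs))) * 2 ^ m
    ≡⟨ cong (_* 2 ^ m) (∑-disjoint j) ⟩
  3 ^ j * 2 ^ m ∎
  where open ≡-Reasoning

^-distribʳ-* : ∀ m n o → (m * n) ^ o ≡ m ^ o * n ^ o
^-distribʳ-* m n zero    = refl
^-distribʳ-* m n (suc o) = begin
  m * n * (m * n) ^ o         ≡⟨ cong (m * n *_) (^-distribʳ-* m n o) ⟩
  m * n * (m ^ o * n ^ o)     ≡⟨ *-interchange m n (m ^ o) (n ^ o) ⟩
  m * m ^ o * (n * n ^ o)     ∎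
  where open ≡-Reasoning

-- Here p = s + d and n = 2p + s.  Increasing s multiplies both sides by 13824,
-- increasing d multiplies them by 432 and by 576; writing n as s * 3 + d * 2 makes
-- both steps unfold definitionally.
cube-bound : ∀ s d → (3 ^ (s + d) * 2 ^ s) ^ 3 * 4 ^ (s * 3 + d * 2)
                     ≤ 3 ^ (s * 3 + d * 2) * (2 ^ (s * 3 + d * 2)) ^ 3
cube-bound zero    zero    = ≤-refl
cube-bound zero    (suc d) = begin
  (3 * 3 ^ d * 1) ^ 3 * (4 * (4 * 4 ^ (d * 2)))   ≡⟨ lhs (3 ^ d) (4 ^ (d * 2)) ⟩
  432 * ((3 ^ d * 1) ^ 3 * 4 ^ (d * 2))           ≤⟨ *-mono-≤ (m≤m+n 432 144) (cube-bound zero d) ⟩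
  576 * (3 ^ (d * 2) * (2 ^ (d * 2)) ^ 3)          ≡⟨ rhs (3 ^ (d * 2)) (2 ^ (d * 2)) ⟩
  3 * (3 * 3 ^ (d * 2)) * (2 * (2 * 2 ^ (d * 2))) ^ 3 ∎
  where
  open ≤-Reasoning
  lhs : ∀ x z → (3 * x * 1) ^ 3 * (4 * (4 * z)) ≡ 432 * ((x * 1) ^ 3 * z)
  lhs = solve 2 (λ x z → (con 3 :* x :* con 1) :^ 3 :* (con 4 :* (con 4 :* z))
                      := con 432 :* ((x :* con 1) :^ 3 :* z)) refl
  rhs : ∀ w y → 576 * (w * y ^ 3) ≡ 3 * (3 * w) * (2 * (2 * y)) ^ 3
  rhs = solve 2 (λ w y → con 576 :* (w :* y :^ 3)
                      := con 3 :* (con 3 :* w) :* (con 2 :* (con 2 :* y)) :^ 3) refl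
cube-bound (suc s) d = begin
  (3 * 3 ^ (s + d) * (2 * 2 ^ s)) ^ 3 * (4 * (4 * (4 * 4 ^ e)))  ≡⟨ lhs (3 ^ (s + d)) (2 ^ s) (4 ^ e) ⟩
  13824 * ((3 ^ (s + d) * 2 ^ s) ^ 3 * 4 ^ e)                    ≤⟨ *-monoʳ-≤ 13824 (cube-bound s d) ⟩
  13824 * (3 ^ e * (2 ^ e) ^ 3)                                   ≡⟨ rhs (3 ^ e) (2 ^ e) ⟩
  3 * (3 * (3 * 3 ^ e)) * (2 * (2 * (2 * 2 ^ e))) ^ 3              ∎
  where
  open ≤-Reasoning
  e = s * 3 + d * 2
  lhs : ∀ x y z → (3 * x * (2 * y)) ^ 3 * (4 * (4 * (4 * z))) ≡ 13824 * ((x * y) ^ 3 * z)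
  lhs = solve 3 (λ x y z → (con 3 :* x :* (con 2 :* y)) :^ 3 :* (con 4 :* (con 4 :* (con 4 :* z)))
                        := con 13824 :* ((x :* y) :^ 3 :* z)) refl
  rhs : ∀ w v → 13824 * (w * v ^ 3) ≡ 3 * (3 * (3 * w)) * (2 * (2 * (2 * v))) ^ 3
  rhs = solve 2 (λ w v → con 13824 :* (w :* v :^ 3)
                      := con 3 :* (con 3 :* (con 3 :* w)) :* (con 2 :* (con 2 :* (con 2 :* v))) :^ 3) refl

-- The cube bound needs s ≤ p (e = 0), which only holds once a block of length 2k
-- has been split off; shorter n need the slack e = k.
record MissBound (n k e : ℕ) : Set where
  field
    p s    : ℕ
    split  : n ≡ p + p + s
    excess : s ≤ e + p
    bound  : missCount n k ≤ 3 ^ p * 2 ^ s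

missBound-weaken : ∀ {e e′} → e ≤ e′ → MissBound n k e → MissBound n k e′
missBound-weaken e≤e′ b = record
  { p = p ; s = s ; split = split ; excess = ≤-trans excess (+-monoˡ-≤ p e≤e′) ; bound = bound }
  where open MissBound b

missBound-short : n ≤ k → MissBound n k k
missBound-short {n} {k} n≤k = record
  { p = 0 ; s = n ; split = refl
  ; excess = ≤-trans n≤k (m≤m+n k 0)
  ; bound  = ≤-trans (missCount≤2^n n k) (≤-reflexive (sym (*-identityˡ (2 ^ n))))
  }

k≤n≤k+k⇒∃[j,m] : k ≤ n → n ≤ k + k → ∃₂ λ j m → n ≡ j + (m + j) × k ≡ m + j
k≤n≤k+k⇒∃[j,m] {k} k≤n n≤k+k with m≤n⇒∃[o]m+o≡n k≤n
... | j , refl with m≤n⇒∃[o]m+o≡n (+-cancelˡ-≤ k j k n≤k+k)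
... | m , refl = j , m , +-assoc j m j , +-comm j m

missBound-medium : k ≤ n → n ≤ k + k → MissBound n k k
missBound-medium k≤n n≤k+k with k≤n≤k+k⇒∃[j,m] k≤n n≤k+k
... | j , m , refl , refl = record
  { p = j ; s = m
  ; split  = trans (cong (j +_) (+-comm m j)) (sym (+-assoc j j m))
  ; excess = ≤-trans (m≤m+n m j) (m≤m+n (m + j) j)
  ; bound  = ≤-reflexive (missCount-exact j m)
  }

missBound-step : MissBound n k k → MissBound (k + k + n) k 0
missBound-step {n} {k} b = record
  { p = k + p ; s = s
  ; split  = trans (cong (k + k +_) split) (regroup k p s)
  ; excess = excess
  ; bound  = begin
      missCount (k + k + n) k              ≤⟨ missCount-++ (k + k) n k ⟩
      missCount (k + k) k * missCount n k  ≤⟨ *-mono-≤ (≤-reflexive (missCount-exact k 0)) bound ⟩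
      3 ^ k * 1 * (3 ^ p * 2 ^ s)          ≡⟨ reassoc (3 ^ k) (3 ^ p) (2 ^ s) ⟩
      3 ^ k * 3 ^ p * 2 ^ s                ≡⟨ cong (_* 2 ^ s) (^-distribˡ-+-* 3 k p) ⟨
      3 ^ (k + p) * 2 ^ s                  ∎
  }
  where
  open MissBound b
  open ≤-Reasoning
  regroup : ∀ k p s → k + k + (p + p + s) ≡ k + p + (k + p) + s
  regroup = solve-∀
  reassoc : ∀ x y z → x * 1 * (y * z) ≡ x * y * z
  reassoc = solve-∀

missBound : 1 ≤ k → ∀ n → MissBound n k k
missBound {k} 1≤k = <-rec (λ n → MissBound n k k) bounded
  where
  bounded : ∀ n → (∀ {r} → r < n → MissBound r k k) → MissBound n k k
  bounded n rec with n ≤? k | n ≤? k + k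
  ... | yes n≤k | _         = missBound-short n≤k
  ... | no n≰k  | yes n≤k+k = missBound-medium (≰⇒≥ n≰k) n≤k+k
  ... | no _    | no n≰k+k  with m≤n⇒∃[o]m+o≡n (≰⇒≥ n≰k+k)
  ...   | r , refl = missBound-weaken z≤n (missBound-step (rec r<k+k+r))
    where
    r<k+k+r : r < k + k + r
    r<k+k+r = +-monoˡ-≤ r (≤-trans 1≤k (m≤m+n k k))

missBound⇒cube : MissBound n k 0 → missCount n k ^ 3 * 4 ^ n ≤ 3 ^ n * (2 ^ n) ^ 3
missBound⇒cube record { p = p ; s = s ; split = refl ; excess = s≤p ; bound = bound }
  with m≤n⇒∃[o]m+o≡n s≤p
... | d , refl = ≤-trans (*-monoˡ-≤ _ (^-monoˡ-≤ 3 bound))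
                         (subst (λ n → (3 ^ (s + d) * 2 ^ s) ^ 3 * 4 ^ n ≤ 3 ^ n * (2 ^ n) ^ 3)
                                (regroup s d) (cube-bound s d))
  where
  regroup : ∀ s d → s * 3 + d * 2 ≡ s + d + (s + d) + s
  regroup = solve-∀

missCount-k≤n/2 : 1 ≤ k → k + k ≤ n → missCount n k ^ 3 * 4 ^ n ≤ 3 ^ n * (2 ^ n) ^ 3
missCount-k≤n/2 {k} 1≤k k+k≤n with m≤n⇒∃[o]m+o≡n k+k≤n
... | r , refl = missBound⇒cube (missBound-step (missBound 1≤k r))

missCount-n/2≤k : k < n → n ≤ k + k → missCount n k * 4 ^ (n ∸ k) ≡ 3 ^ (n ∸ k) * 2 ^ n
missCount-n/2≤k k<n n≤k+k with k≤n≤k+k⇒∃[j,m] (<⇒≤ k<n) n≤k+k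
... | j , m , refl , refl rewrite m+n∸n≡m j (m + j) = begin
  missCount (j + (m + j)) (m + j) * 4 ^ j
    ≡⟨ cong (_* 4 ^ j) (missCount-exact j m) ⟩
  3 ^ j * 2 ^ m * 4 ^ j
    ≡⟨ cong (3 ^ j * 2 ^ m *_) (^-distribʳ-* 2 2 j) ⟩
  3 ^ j * 2 ^ m * (2 ^ j * 2 ^ j)
    ≡⟨ regroup (3 ^ j) (2 ^ m) (2 ^ j) ⟩
  3 ^ j * (2 ^ j * (2 ^ m * 2 ^ j))
    ≡⟨ cong (λ t → 3 ^ j * (2 ^ j * t)) (^-distribˡ-+-* 2 m j) ⟨
  3 ^ j * (2 ^ j * 2 ^ (m + j))
    ≡⟨ cong (3 ^ j *_) (^-distribˡ-+-* 2 j (m + j)) ⟨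
  3 ^ j * 2 ^ (j + (m + j)) ∎
  where
  open ≡-Reasoning
  regroup : ∀ a b c → a * b * (c * c) ≡ a * (c * (b * c))
  regroup = solve-∀

lemma12 : (n : ℕ) →
    ((k : ℕ) → 1 ≤ k → 2 * k ≤ n →
       missCount n k ^ 3 * 4 ^ n ≤ 3 ^ n * (2 ^ n) ^ 3)
    × ((k : ℕ) → n ≤ 2 * k → k < n →
       missCount n k * 4 ^ (n ∸ k) ≡ 3 ^ (n ∸ k) * 2 ^ n)
lemma12 n =
    (λ k 1≤k 2k≤n → missCount-k≤n/2 1≤k (subst (_≤ n) (2*k≡k+k k) 2k≤n))
  , (λ k n≤2k k<n → missCount-n/2≤k k<n (subst (n ≤_) (2*k≡k+k k) n≤2k))
  where
  2*k≡k+k : ∀ k → 2 * k ≡ k + k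
  2*k≡k+k k = cong (k +_) (+-identityʳ k)
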